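{- Let $v>k>i\ge 0$ be integers with $v\ge 2k$ and $(v,k,i)\neq(2k,k,0)$, let $X=J(v,k,i)$ and $\Delta=v-2k+2i$. Let $A,B$ be vertices of $X$ with $x=|A\cap B|>i$. Then $$\mathrm{dist}(A,B)=\min\left\{2\left\lceil\frac{k-x}{\Delta}\right\rceil,\ 2\left\lceil\frac{x-i}{\Delta}\right\rceil+1\right\}.$$
   Context: For integers $v>k>i\ge 0$, the generalized Johnson graph $J(v,k,i)$ is the simple undirected graph whose vertices are the $k$-element subsets of a fixed $v$-element set, two vertices $A,B$ being adjacent iff $|A\cap B|=i$. $\mathrm{dist}$ denotes the graph distance. -}

module Defs where

open import Data.Nat using (ℕ; zero; suc; _+_; _≤_; _⊓_)
open import Data.Nat.DivMod using (_/_)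
open import Data.Fin.Subset using (Subset; _∩_; ∣_∣)
open import Data.Product using (_×_)
open import Relation.Binary.PropositionalEquality using (_≡_)

-- Vertices of J(v,k,i): k-element subsets of Fin v (a Subset v with ∣ A ∣ ≡ k).
-- Adjacency in J(v,k,i): |A ∩ B| = i.
Adj : (v k i : ℕ) → Subset v → Subset v → Set
Adj v k i A B = ∣ A ∩ B ∣ ≡ i

data Walk (v k i : ℕ) : Subset v → Subset v → ℕ → Set where
  here : ∀ {A} → Walk v k i A A 0
  step : ∀ {A B C n} → ∣ B ∣ ≡ k → Adj v k i A B → Walk v k i B C n →
         Walk v k i A C (suc n)

IsDist : (v k i : ℕ) → Subset v → Subset v → ℕ → Set
IsDist v k i A B d = Walk v k i A B d × (∀ m → Walk v k i A B m → d ≤ m)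

-- Ceiling division ⌈a / d⌉ for d > 0 (value at d = 0 is irrelevant, set to 0).
ceilDiv : ℕ → ℕ → ℕ
ceilDiv a zero = 0
ceilDiv a (suc d) = (a + d) / suc d

-- For k-sets C, D, B with |C ∩ D| = i, counting over the Venn regions gives
-- |C ∩ B| + |D ∩ B| ≤ i + k ≤ |C ∩ B| + |D ∩ B| + Δ, and conversely, when |C ∩ B| ≥ i, every
-- y ≥ i in that window is |D ∩ B| for some neighbour D of C.  So along a walk to B the size
-- x = |C ∩ B| is reflected as x ↦ i + k − x at each step, up to a loss of at most Δ: a walk of
-- length 2t exists iff k ≤ x + tΔ, and one of length 2t + 1 iff x ≤ i + tΔ.  The least t of
-- each parity is the corresponding ceiling, and the distance is the smaller of the two lengths.
module Submission where

open import Defs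
open import Data.Nat using (ℕ; zero; suc; _+_; _*_; _∸_; _≤_; _<_; _⊓_; z≤n; s≤s)
open import Data.Nat.Properties
open import Data.Nat.DivMod using (_/_; _%_; m≡m%n+[m/n]*n; m%n<n; m<n*o⇒m/o<n)
open import Data.Nat.Tactic.RingSolver using (solve-∀)
open import Data.Fin.Subset using (Subset; inside; outside; _∩_; _∪_; _─_; ∁; _⊆_; ∣_∣)
open import Data.Fin.Subset.Properties
  using (∣p∩q∣≤∣p∣; ∣p∣≤n; ∣∁p∣≡n∸∣p∣; p∩q⊆q; p⊆q⇒∣p∣≤∣q∣;
         x∈p∩q⁺; x∈p∩q⁻; out⊆; in⊆in; ⊆-antisym; ∩-comm; ∩-idem; ∩-distribʳ-∪)
open import Data.Vec using ([]; _∷_)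
open import Data.Product using (_×_; _,_; proj₁; ∃-syntax)
open import Data.Sum using (_⊎_; inj₁; inj₂)
open import Relation.Binary.PropositionalEquality
open import Relation.Nullary using (¬_; contradiction)

private
  variable
    n : ℕ

∣p∩q∣+∣p─q∣≡∣p∣ : ∀ (p q : Subset n) → ∣ p ∩ q ∣ + ∣ p ─ q ∣ ≡ ∣ p ∣
∣p∩q∣+∣p─q∣≡∣p∣ []            []            = refl
∣p∩q∣+∣p─q∣≡∣p∣ (inside ∷ p)  (inside ∷ q)  = cong suc (∣p∩q∣+∣p─q∣≡∣p∣ p q)
∣p∩q∣+∣p─q∣≡∣p∣ (inside ∷ p)  (outside ∷ q) =
  trans (+-suc ∣ p ∩ q ∣ ∣ p ─ q ∣) (cong suc (∣p∩q∣+∣p─q∣≡∣p∣ p q))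
∣p∩q∣+∣p─q∣≡∣p∣ (outside ∷ p) (inside ∷ q)  = ∣p∩q∣+∣p─q∣≡∣p∣ p q
∣p∩q∣+∣p─q∣≡∣p∣ (outside ∷ p) (outside ∷ q) = ∣p∩q∣+∣p─q∣≡∣p∣ p q

∣p∪q∣+∣p∩q∣≡∣p∣+∣q∣ : ∀ (p q : Subset n) → ∣ p ∪ q ∣ + ∣ p ∩ q ∣ ≡ ∣ p ∣ + ∣ q ∣
∣p∪q∣+∣p∩q∣≡∣p∣+∣q∣ []            []            = refl
∣p∪q∣+∣p∩q∣≡∣p∣+∣q∣ (inside ∷ p)  (inside ∷ q)  = cong suc (begin
  ∣ p ∪ q ∣ + suc ∣ p ∩ q ∣ ≡⟨ +-suc _ _ ⟩
  suc (∣ p ∪ q ∣ + ∣ p ∩ q ∣) ≡⟨ cong suc (∣p∪q∣+∣p∩q∣≡∣p∣+∣q∣ p q) ⟩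
  suc (∣ p ∣ + ∣ q ∣) ≡⟨ sym (+-suc _ _) ⟩
  ∣ p ∣ + suc ∣ q ∣ ∎)
  where open ≡-Reasoning
∣p∪q∣+∣p∩q∣≡∣p∣+∣q∣ (inside ∷ p)  (outside ∷ q) = cong suc (∣p∪q∣+∣p∩q∣≡∣p∣+∣q∣ p q)
∣p∪q∣+∣p∩q∣≡∣p∣+∣q∣ (outside ∷ p) (inside ∷ q)  =
  trans (cong suc (∣p∪q∣+∣p∩q∣≡∣p∣+∣q∣ p q)) (sym (+-suc ∣ p ∣ ∣ q ∣))
∣p∪q∣+∣p∩q∣≡∣p∣+∣q∣ (outside ∷ p) (outside ∷ q) = ∣p∪q∣+∣p∩q∣≡∣p∣+∣q∣ p q

∣p∪q∣≤∣p∣+∣q∣ : ∀ (p q : Subset n) → ∣ p ∪ q ∣ ≤ ∣ p ∣ + ∣ q ∣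
∣p∪q∣≤∣p∣+∣q∣ p q = subst (∣ p ∪ q ∣ ≤_) (∣p∪q∣+∣p∩q∣≡∣p∣+∣q∣ p q) (m≤m+n _ _)

∣p∣+∣∁p∣≡n : ∀ (p : Subset n) → ∣ p ∣ + ∣ ∁ p ∣ ≡ n
∣p∣+∣∁p∣≡n p = trans (cong (∣ p ∣ +_) (∣∁p∣≡n∸∣p∣ p)) (m+[n∸m]≡n (∣p∣≤n p))

∣p∩q∣≡∣p∣⇒p⊆q : ∀ {p q : Subset n} → ∣ p ∩ q ∣ ≡ ∣ p ∣ → p ⊆ q
∣p∩q∣≡∣p∣⇒p⊆q {p = []}          {[]}          _  = λ ()
∣p∩q∣≡∣p∣⇒p⊆q {p = inside ∷ p}  {inside ∷ q}  eq = in⊆in (∣p∩q∣≡∣p∣⇒p⊆q (suc-injective eq))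
∣p∩q∣≡∣p∣⇒p⊆q {p = inside ∷ p}  {outside ∷ q} eq =
  contradiction (subst (_≤ ∣ p ∣) eq (∣p∩q∣≤∣p∣ p q)) (<-irrefl refl)
∣p∩q∣≡∣p∣⇒p⊆q {p = outside ∷ p} {_ ∷ q}       eq = out⊆ (∣p∩q∣≡∣p∣⇒p⊆q eq)

∣p∩r∣+∣q∩r∣≤∣p∩q∣+∣r∣ : ∀ (p q r : Subset n) → ∣ p ∩ r ∣ + ∣ q ∩ r ∣ ≤ ∣ p ∩ q ∣ + ∣ r ∣
∣p∩r∣+∣q∩r∣≤∣p∩q∣+∣r∣ p q r = begin
  ∣ p ∩ r ∣ + ∣ q ∩ r ∣                             ≡⟨ ∣p∪q∣+∣p∩q∣≡∣p∣+∣q∣ (p ∩ r) (q ∩ r) ⟨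
  ∣ (p ∩ r) ∪ (q ∩ r) ∣ + ∣ (p ∩ r) ∩ (q ∩ r) ∣     ≤⟨ +-mono-≤ (p⊆q⇒∣p∣≤∣q∣ union⊆r) (p⊆q⇒∣p∣≤∣q∣ meet⊆p∩q) ⟩
  ∣ r ∣ + ∣ p ∩ q ∣                                 ≡⟨ +-comm ∣ r ∣ _ ⟩
  ∣ p ∩ q ∣ + ∣ r ∣                                 ∎
  where
  open ≤-Reasoning
  union⊆r : (p ∩ r) ∪ (q ∩ r) ⊆ r
  union⊆r = subst (_⊆ r) (∩-distribʳ-∪ r p q) (p∩q⊆q (p ∪ q) r)
  meet⊆p∩q : (p ∩ r) ∩ (q ∩ r) ⊆ p ∩ q
  meet⊆p∩q x∈ with x∈p∩q⁻ (p ∩ r) (q ∩ r) x∈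
  ... | x∈p∩r , x∈q∩r = x∈p∩q⁺ (proj₁ (x∈p∩q⁻ p r x∈p∩r) , proj₁ (x∈p∩q⁻ q r x∈q∩r))

∣p∣+∣q∣+∣r∣≤∣p∩r∣+∣q∩r∣+∣p∩q∣+n : ∀ (p q r : Subset n) →
  ∣ p ∣ + ∣ q ∣ + ∣ r ∣ ≤ ∣ p ∩ r ∣ + ∣ q ∩ r ∣ + ∣ p ∩ q ∣ + n
∣p∣+∣q∣+∣r∣≤∣p∩r∣+∣q∩r∣+∣p∩q∣+n {n} p q r = begin
  ∣ p ∣ + ∣ q ∣ + ∣ r ∣
    ≡⟨ cong (_+ ∣ r ∣) (∣p∪q∣+∣p∩q∣≡∣p∣+∣q∣ p q) ⟨
  ∣ p ∪ q ∣ + ∣ p ∩ q ∣ + ∣ r ∣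
    ≡⟨ swap-last (∣ p ∪ q ∣) _ _ ⟩
  ∣ p ∪ q ∣ + ∣ r ∣ + ∣ p ∩ q ∣
    ≡⟨ cong (_+ ∣ p ∩ q ∣) (∣p∪q∣+∣p∩q∣≡∣p∣+∣q∣ (p ∪ q) r) ⟨
  ∣ (p ∪ q) ∪ r ∣ + ∣ (p ∪ q) ∩ r ∣ + ∣ p ∩ q ∣
    ≡⟨ cong (λ s → ∣ (p ∪ q) ∪ r ∣ + ∣ s ∣ + ∣ p ∩ q ∣) (∩-distribʳ-∪ r p q) ⟩
  ∣ (p ∪ q) ∪ r ∣ + ∣ (p ∩ r) ∪ (q ∩ r) ∣ + ∣ p ∩ q ∣
    ≤⟨ +-monoˡ-≤ ∣ p ∩ q ∣ (+-mono-≤ (∣p∣≤n ((p ∪ q) ∪ r)) (∣p∪q∣≤∣p∣+∣q∣ (p ∩ r) (q ∩ r))) ⟩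
  n + (∣ p ∩ r ∣ + ∣ q ∩ r ∣) + ∣ p ∩ q ∣
    ≡⟨ rearrange n (∣ p ∩ r ∣) (∣ q ∩ r ∣) (∣ p ∩ q ∣) ⟩
  ∣ p ∩ r ∣ + ∣ q ∩ r ∣ + ∣ p ∩ q ∣ + n ∎
  where
  open ≤-Reasoning
  rearrange : ∀ a b c d → a + (b + c) + d ≡ b + c + d + a
  rearrange = solve-∀
  swap-last : ∀ a b c → a + b + c ≡ a + c + b
  swap-last = solve-∀

subset-with-Venn-counts : ∀ (p q : Subset n) {a b c d : ℕ} →
  a ≤ ∣ p ∩ q ∣ → b ≤ ∣ p ─ q ∣ → c ≤ ∣ q ─ p ∣ → d ≤ ∣ ∁ (p ∪ q) ∣ →
  ∃[ r ] ∣ r ∣ ≡ a + b + c + d × ∣ p ∩ r ∣ ≡ a + b × ∣ r ∩ q ∣ ≡ a + c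
subset-with-Venn-counts [] [] z≤n z≤n z≤n z≤n = [] , refl , refl , refl
subset-with-Venn-counts (inside ∷ p) (inside ∷ q) {zero} _ b≤ c≤ d≤
  with r , ∣r∣ , ∣p∩r∣ , ∣r∩q∣ ← subset-with-Venn-counts p q z≤n b≤ c≤ d≤
  = outside ∷ r , ∣r∣ , ∣p∩r∣ , ∣r∩q∣
subset-with-Venn-counts (inside ∷ p) (inside ∷ q) {suc a} (s≤s a≤) b≤ c≤ d≤
  with r , ∣r∣ , ∣p∩r∣ , ∣r∩q∣ ← subset-with-Venn-counts p q a≤ b≤ c≤ d≤
  = inside ∷ r , cong suc ∣r∣ , cong suc ∣p∩r∣ , cong suc ∣r∩q∣
subset-with-Venn-counts (inside ∷ p) (outside ∷ q) {b = zero} a≤ _ c≤ d≤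
  with r , ∣r∣ , ∣p∩r∣ , ∣r∩q∣ ← subset-with-Venn-counts p q a≤ z≤n c≤ d≤
  = outside ∷ r , ∣r∣ , ∣p∩r∣ , ∣r∩q∣
subset-with-Venn-counts (inside ∷ p) (outside ∷ q) {a} {suc b} {c} {d} a≤ (s≤s b≤) c≤ d≤
  with r , ∣r∣ , ∣p∩r∣ , ∣r∩q∣ ← subset-with-Venn-counts p q a≤ b≤ c≤ d≤
  = inside ∷ r
  , trans (cong suc ∣r∣) (cong (λ s → s + c + d) (sym (+-suc a b)))
  , trans (cong suc ∣p∩r∣) (sym (+-suc a b))
  , ∣r∩q∣
subset-with-Venn-counts (outside ∷ p) (inside ∷ q) {c = zero} a≤ b≤ _ d≤
  with r , ∣r∣ , ∣p∩r∣ , ∣r∩q∣ ← subset-with-Venn-counts p q a≤ b≤ z≤n d≤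
  = outside ∷ r , ∣r∣ , ∣p∩r∣ , ∣r∩q∣
subset-with-Venn-counts (outside ∷ p) (inside ∷ q) {a} {b} {suc c} {d} a≤ b≤ (s≤s c≤) d≤
  with r , ∣r∣ , ∣p∩r∣ , ∣r∩q∣ ← subset-with-Venn-counts p q a≤ b≤ c≤ d≤
  = inside ∷ r
  , trans (cong suc ∣r∣) (cong (_+ d) (sym (+-suc (a + b) c)))
  , ∣p∩r∣
  , trans (cong suc ∣r∩q∣) (sym (+-suc a c))
subset-with-Venn-counts (outside ∷ p) (outside ∷ q) {d = zero} a≤ b≤ c≤ _
  with r , ∣r∣ , ∣p∩r∣ , ∣r∩q∣ ← subset-with-Venn-counts p q a≤ b≤ c≤ z≤n
  = outside ∷ r , ∣r∣ , ∣p∩r∣ , ∣r∩q∣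
subset-with-Venn-counts (outside ∷ p) (outside ∷ q) {a} {b} {c} {suc d} a≤ b≤ c≤ (s≤s d≤)
  with r , ∣r∣ , ∣p∩r∣ , ∣r∩q∣ ← subset-with-Venn-counts p q a≤ b≤ c≤ d≤
  = inside ∷ r , trans (cong suc ∣r∣) (sym (+-suc (a + b + c) d)) , ∣p∩r∣ , ∣r∩q∣

-- a, b, c, d are how many points a neighbour D of C takes from the regions C ∩ B, C ─ B, B ─ C
-- and ∁ (C ∪ B), of sizes x, e, e, o; the neighbour then has |D| = x + e, |C ∩ D| = i, |D ∩ B| = y.
Venn-quotas : ∀ {x e o i y : ℕ} → i ≤ x → i ≤ y → y ≤ i + e → x + e ≤ i + y + o → x ≤ o →
  ∃[ a ] ∃[ b ] ∃[ c ] ∃[ d ]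
    (a ≤ x × b ≤ e × c ≤ e × d ≤ o) × (a + b + c + d ≡ x + e × a + b ≡ i × a + c ≡ y)
Venn-quotas {x} {e} {o} {i} {y} i≤x i≤y y≤i+e x+e≤i+y+o x≤o with ≤-total e y
... | inj₁ e≤y with a , refl ← m≤n⇒∃[o]m+o≡n e≤y
               with b , refl ← m≤n⇒∃[o]m+o≡n (+-cancelˡ-≤ e a i (subst (e + a ≤_) (+-comm i e) y≤i+e))
               with d , refl ← m≤n⇒∃[o]m+o≡n i≤x
  = a , b , e , d
  , (≤-trans (m≤m+n a b) (m≤m+n (a + b) d) , +-cancelˡ-≤ a b e (subst (a + b ≤_) (+-comm e a) i≤y) , ≤-refl
    , ≤-trans (m≤n+m d (a + b)) x≤o)
  , shuffle a b e d , refl , +-comm a e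
  where
  shuffle : ∀ a b e d → a + b + e + d ≡ a + b + d + e
  shuffle = solve-∀
... | inj₂ y≤e with s , refl ← m≤n⇒∃[o]m+o≡n i≤x
               with t , refl ← m≤n⇒∃[o]m+o≡n y≤e
  = 0 , i , y , s + t
  , (z≤n , ≤-trans i≤y (m≤m+n y t) , m≤m+n y t
    , +-cancelˡ-≤ (i + y) (s + t) o (subst (_≤ i + y + o) (shuffle i s y t) x+e≤i+y+o))
  , sym (shuffle i s y t) , refl , refl
  where
  shuffle : ∀ i s y t → i + s + (y + t) ≡ i + y + (s + t)
  shuffle = solve-∀

∃-neighbour-meeting : ∀ {v k i Δ r} (C B : Subset v) (y : ℕ) → 2 * k ≤ v → Δ + 2 * k ≡ v + 2 * i →
  ∣ C ∣ ≡ k → ∣ B ∣ ≡ k → i ≤ ∣ C ∩ B ∣ →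
  i ≤ y → r ≤ Δ → ∣ C ∩ B ∣ + y + r ≡ k + i →
  ∃[ D ] ∣ D ∣ ≡ k × Adj v k i C D × ∣ D ∩ B ∣ ≡ y
∃-neighbour-meeting {v} {k} {i} {Δ} {r} C B y 2k≤v Δ+2k≡v+2i ∣C∣≡k ∣B∣≡k i≤x i≤y r≤Δ x+y+r≡k+i
  = neighbour
  where
  x e o u : ℕ
  x = ∣ C ∩ B ∣
  e = ∣ C ─ B ∣
  o = ∣ ∁ (C ∪ B) ∣
  u = ∣ C ∪ B ∣
  x+e≡k : x + e ≡ k
  x+e≡k = trans (∣p∩q∣+∣p─q∣≡∣p∣ C B) ∣C∣≡k
  ∣B─C∣≡e : ∣ B ─ C ∣ ≡ e
  ∣B─C∣≡e = +-cancelˡ-≡ x _ _ (begin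
    x + ∣ B ─ C ∣         ≡⟨ cong (λ s → ∣ s ∣ + ∣ B ─ C ∣) (∩-comm C B) ⟩
    ∣ B ∩ C ∣ + ∣ B ─ C ∣ ≡⟨ ∣p∩q∣+∣p─q∣≡∣p∣ B C ⟩
    ∣ B ∣                 ≡⟨ trans ∣B∣≡k (sym x+e≡k) ⟩
    x + e                 ∎)
    where open ≡-Reasoning
  u+x≡2k : u + x ≡ 2 * k
  u+x≡2k = trans (∣p∪q∣+∣p∩q∣≡∣p∣+∣q∣ C B)
                 (cong₂ _+_ ∣C∣≡k (trans ∣B∣≡k (sym (+-identityʳ k))))
  u+o≡v : u + o ≡ v
  u+o≡v = ∣p∣+∣∁p∣≡n (C ∪ B)
  x≤o : x ≤ o
  x≤o = +-cancelˡ-≤ u x o (subst₂ _≤_ (sym u+x≡2k) (sym u+o≡v) 2k≤v)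
  y≤i+e : y ≤ i + e
  y≤i+e = +-cancelˡ-≤ x y (i + e) (begin
    x + y         ≤⟨ m≤m+n (x + y) r ⟩
    x + y + r     ≡⟨ x+y+r≡k+i ⟩
    k + i         ≡⟨ cong (_+ i) (sym x+e≡k) ⟩
    x + e + i     ≡⟨ shape x e i ⟩
    x + (i + e)   ∎)
    where
    open ≤-Reasoning
    shape : ∀ x e i → x + e + i ≡ x + (i + e)
    shape = solve-∀
  k+i≤x+y+Δ : k + i ≤ x + y + Δ
  k+i≤x+y+Δ = subst (_≤ x + y + Δ) x+y+r≡k+i (+-monoʳ-≤ (x + y) r≤Δ)
  x+e≤i+y+o : x + e ≤ i + y + o
  x+e≤i+y+o = +-cancelʳ-≤ (u + x + i) (x + e) (i + y + o) (begin
    x + e + (u + x + i)       ≡⟨ cong₂ (λ s t → s + (t + i)) x+e≡k u+x≡2k ⟩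
    k + (2 * k + i)           ≡⟨ lhs-shape k i ⟩
    k + i + 2 * k             ≤⟨ +-monoˡ-≤ (2 * k) k+i≤x+y+Δ ⟩
    x + y + Δ + 2 * k         ≡⟨ +-assoc (x + y) Δ (2 * k) ⟩
    x + y + (Δ + 2 * k)       ≡⟨ cong (x + y +_) (trans Δ+2k≡v+2i (cong (_+ 2 * i) (sym u+o≡v))) ⟩
    x + y + (u + o + 2 * i)   ≡⟨ rhs-shape x y u o i ⟩
    i + y + o + (u + x + i)   ∎)
    where
    open ≤-Reasoning
    lhs-shape : ∀ k i → k + (2 * k + i) ≡ k + i + 2 * k
    lhs-shape = solve-∀
    rhs-shape : ∀ x y u o i → x + y + (u + o + 2 * i) ≡ i + y + o + (u + x + i)
    rhs-shape = solve-∀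
  neighbour : ∃[ D ] ∣ D ∣ ≡ k × Adj v k i C D × ∣ D ∩ B ∣ ≡ y
  neighbour
    with a , b , c , d , (a≤x , b≤e , c≤e , d≤o) , (a+b+c+d≡x+e , a+b≡i , a+c≡y)
           ← Venn-quotas i≤x i≤y y≤i+e x+e≤i+y+o x≤o
    with D , ∣D∣≡a+b+c+d , ∣C∩D∣≡a+b , ∣D∩B∣≡a+c
           ← subset-with-Venn-counts C B a≤x b≤e (subst (c ≤_) (sym ∣B─C∣≡e) c≤e) d≤o
    = D , trans ∣D∣≡a+b+c+d (trans a+b+c+d≡x+e x+e≡k) , trans ∣C∩D∣≡a+b a+b≡i , trans ∣D∩B∣≡a+c a+c≡y

neighbour-sum-upper : ∀ {v k i} (C D B : Subset v) → ∣ B ∣ ≡ k → Adj v k i C D →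
  ∣ C ∩ B ∣ + ∣ D ∩ B ∣ ≤ i + k
neighbour-sum-upper C D B ∣B∣≡k ∣C∩D∣≡i =
  subst₂ (λ s t → ∣ C ∩ B ∣ + ∣ D ∩ B ∣ ≤ s + t) ∣C∩D∣≡i ∣B∣≡k (∣p∩r∣+∣q∩r∣≤∣p∩q∣+∣r∣ C D B)

neighbour-sum-lower : ∀ {v k i Δ} (C D B : Subset v) → Δ + 2 * k ≡ v + 2 * i →
  ∣ C ∣ ≡ k → ∣ D ∣ ≡ k → ∣ B ∣ ≡ k → Adj v k i C D →
  k + i ≤ ∣ C ∩ B ∣ + ∣ D ∩ B ∣ + Δ
neighbour-sum-lower {v} {k} {i} {Δ} C D B Δ+2k≡v+2i ∣C∣≡k ∣D∣≡k ∣B∣≡k ∣C∩D∣≡i =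
  +-cancelʳ-≤ (2 * k) (k + i) (x + y + Δ) (begin
    k + i + 2 * k             ≡⟨ lhs-shape k i ⟩
    k + k + k + i             ≡⟨ cong (λ s → s + i) (sym (cong₂ (λ a b → a + b + k) ∣C∣≡k ∣D∣≡k)) ⟩
    ∣ C ∣ + ∣ D ∣ + k + i     ≤⟨ +-monoˡ-≤ i (subst (λ s → ∣ C ∣ + ∣ D ∣ + s ≤ x + y + ∣ C ∩ D ∣ + v)
                                   ∣B∣≡k (∣p∣+∣q∣+∣r∣≤∣p∩r∣+∣q∩r∣+∣p∩q∣+n C D B)) ⟩
    x + y + ∣ C ∩ D ∣ + v + i ≡⟨ cong (λ s → x + y + s + v + i) ∣C∩D∣≡i ⟩
    x + y + i + v + i         ≡⟨ rhs-shape (x + y) i v ⟩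
    x + y + (v + 2 * i)       ≡⟨ cong (x + y +_) Δ+2k≡v+2i ⟨
    x + y + (Δ + 2 * k)       ≡⟨ +-assoc (x + y) Δ (2 * k) ⟨
    x + y + Δ + 2 * k         ∎)
  where
  open ≤-Reasoning
  x y : ℕ
  x = ∣ C ∩ B ∣
  y = ∣ D ∩ B ∣
  lhs-shape : ∀ k i → k + i + 2 * k ≡ k + k + k + i
  lhs-shape = solve-∀
  rhs-shape : ∀ z i v → z + i + v + i ≡ z + (v + 2 * i)
  rhs-shape = solve-∀

even-walk-bound : ∀ {v k i Δ} {C B : Subset v} → Δ + 2 * k ≡ v + 2 * i →
  ∣ C ∣ ≡ k → ∣ B ∣ ≡ k → ∀ t → Walk v k i C B (t + t) → k ≤ ∣ C ∩ B ∣ + t * Δ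
odd-walk-bound : ∀ {v k i Δ} {C B : Subset v} → Δ + 2 * k ≡ v + 2 * i →
  ∣ C ∣ ≡ k → ∣ B ∣ ≡ k → ∀ t → Walk v k i C B (suc (t + t)) → ∣ C ∩ B ∣ ≤ i + t * Δ

even-walk-bound {C = C} _ ∣C∣≡k _ zero here =
  ≤-reflexive (sym (trans (+-identityʳ _) (trans (cong ∣_∣ (∩-idem C)) ∣C∣≡k)))
even-walk-bound {k = k} {i} {Δ} {C} {B} Δ+2k≡v+2i ∣C∣≡k ∣B∣≡k (suc t) (step {B = D} ∣D∣≡k adj w) =
  +-cancelʳ-≤ i k (∣ C ∩ B ∣ + (Δ + t * Δ)) (begin
    k + i                                 ≤⟨ neighbour-sum-lower C D B Δ+2k≡v+2i ∣C∣≡k ∣D∣≡k ∣B∣≡k adj ⟩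
    ∣ C ∩ B ∣ + ∣ D ∩ B ∣ + Δ             ≤⟨ +-monoˡ-≤ Δ (+-monoʳ-≤ ∣ C ∩ B ∣ y≤i+tΔ) ⟩
    ∣ C ∩ B ∣ + (i + t * Δ) + Δ           ≡⟨ shape ∣ C ∩ B ∣ i (t * Δ) Δ ⟩
    ∣ C ∩ B ∣ + (Δ + t * Δ) + i           ∎)
  where
  open ≤-Reasoning
  y≤i+tΔ : ∣ D ∩ B ∣ ≤ i + t * Δ
  y≤i+tΔ = odd-walk-bound Δ+2k≡v+2i ∣D∣≡k ∣B∣≡k t (subst (Walk _ k i D B) (+-suc t t) w)
  shape : ∀ x i s Δ → x + (i + s) + Δ ≡ x + (Δ + s) + i
  shape = solve-∀

odd-walk-bound {k = k} {i} {Δ} {C} {B} Δ+2k≡v+2i ∣C∣≡k ∣B∣≡k t (step {B = D} ∣D∣≡k adj w) =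
  +-cancelʳ-≤ k ∣ C ∩ B ∣ (i + t * Δ) (begin
    ∣ C ∩ B ∣ + k                         ≤⟨ +-monoʳ-≤ ∣ C ∩ B ∣ k≤y+tΔ ⟩
    ∣ C ∩ B ∣ + (∣ D ∩ B ∣ + t * Δ)       ≡⟨ +-assoc ∣ C ∩ B ∣ _ _ ⟨
    ∣ C ∩ B ∣ + ∣ D ∩ B ∣ + t * Δ         ≤⟨ +-monoˡ-≤ (t * Δ) (neighbour-sum-upper C D B ∣B∣≡k adj) ⟩
    i + k + t * Δ                         ≡⟨ +-right-comm i k (t * Δ) ⟩
    i + t * Δ + k                         ∎)
  where
  open ≤-Reasoning
  k≤y+tΔ : k ≤ ∣ D ∩ B ∣ + t * Δ
  k≤y+tΔ = even-walk-bound Δ+2k≡v+2i ∣D∣≡k ∣B∣≡k t w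
  +-right-comm : ∀ a b c → a + b + c ≡ a + c + b
  +-right-comm = solve-∀

_++ᵂ_ : ∀ {v k i m n} {A B C : Subset v} →
  Walk v k i A B m → Walk v k i B C n → Walk v k i A C (m + n)
here             ++ᵂ w′ = w′
step ∣B∣≡k adj w ++ᵂ w′ = step ∣B∣≡k adj (w ++ᵂ w′)

two-steps-closer : ∀ {v k i Δ r} {C B : Subset v} → 2 * k ≤ v → Δ + 2 * k ≡ v + 2 * i →
  ∣ C ∣ ≡ k → ∣ B ∣ ≡ k → i ≤ ∣ C ∩ B ∣ → r ≤ Δ → ∣ C ∩ B ∣ + r ≤ k →
  ∃[ C′ ] ∣ C′ ∣ ≡ k × Walk v k i C C′ 2 × ∣ C′ ∩ B ∣ ≡ ∣ C ∩ B ∣ + r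
-- Step out to D losing r against the reflection (|D ∩ B| = i + k − (x + r)), then reflect back losslessly.
two-steps-closer {v} {k} {i} {Δ} {r} {C} {B} 2k≤v Δ+2k≡v+2i ∣C∣≡k ∣B∣≡k i≤x r≤Δ x+r≤k =
  from-D (∃-neighbour-meeting C B (i + s) 2k≤v Δ+2k≡v+2i ∣C∣≡k ∣B∣≡k i≤x (m≤m+n i s) r≤Δ
            (trans (out-balance x i r s) (cong (_+ i) x+r+s≡k)))
  where
  x s : ℕ
  x = ∣ C ∩ B ∣
  s = k ∸ (x + r)
  x+r+s≡k : x + r + s ≡ k
  x+r+s≡k = m+[n∸m]≡n x+r≤k
  out-balance : ∀ x i r s → x + (i + s) + r ≡ x + r + s + i
  out-balance = solve-∀
  back-balance : ∀ x i r s → i + s + (x + r) + 0 ≡ x + r + s + i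
  back-balance = solve-∀
  from-D : ∃[ D ] ∣ D ∣ ≡ k × Adj v k i C D × ∣ D ∩ B ∣ ≡ i + s →
           ∃[ C′ ] ∣ C′ ∣ ≡ k × Walk v k i C C′ 2 × ∣ C′ ∩ B ∣ ≡ x + r
  from-D (D , ∣D∣≡k , C~D , ∣D∩B∣≡i+s) =
    let C′ , ∣C′∣≡k , D~C′ , ∣C′∩B∣≡x+r =
          ∃-neighbour-meeting D B (x + r) 2k≤v Δ+2k≡v+2i ∣D∣≡k ∣B∣≡k
            (subst (i ≤_) (sym ∣D∩B∣≡i+s) (m≤m+n i s)) (≤-trans i≤x (m≤m+n x r)) (z≤n {n = Δ})
            (trans (cong (λ y → y + (x + r) + 0) ∣D∩B∣≡i+s)
                   (trans (back-balance x i r s) (cong (_+ i) x+r+s≡k)))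
    in C′ , ∣C′∣≡k , step ∣D∣≡k C~D (step ∣C′∣≡k D~C′ here) , ∣C′∩B∣≡x+r

even-walk : ∀ {v k i Δ} {C B : Subset v} → 2 * k ≤ v → Δ + 2 * k ≡ v + 2 * i →
  ∣ C ∣ ≡ k → ∣ B ∣ ≡ k → i ≤ ∣ C ∩ B ∣ → ∀ t → k ≤ ∣ C ∩ B ∣ + t * Δ → Walk v k i C B (t + t)
even-walk {k = k} {C = C} {B} _ _ ∣C∣≡k ∣B∣≡k _ zero k≤x+0 = subst (λ X → Walk _ k _ C X 0) C≡B here
  where
  x≡k : ∣ C ∩ B ∣ ≡ k
  x≡k = ≤-antisym (subst (∣ C ∩ B ∣ ≤_) ∣C∣≡k (∣p∩q∣≤∣p∣ C B))
                  (subst (k ≤_) (+-identityʳ _) k≤x+0)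
  C≡B : C ≡ B
  C≡B = ⊆-antisym (∣p∩q∣≡∣p∣⇒p⊆q (trans x≡k (sym ∣C∣≡k)))
                  (∣p∩q∣≡∣p∣⇒p⊆q (trans (cong ∣_∣ (∩-comm B C)) (trans x≡k (sym ∣B∣≡k))))
even-walk {v} {k} {i} {Δ} {C} {B} 2k≤v Δ+2k≡v+2i ∣C∣≡k ∣B∣≡k i≤x (suc t) k≤x+Δ+tΔ =
  from-C′ (two-steps-closer 2k≤v Δ+2k≡v+2i ∣C∣≡k ∣B∣≡k i≤x (m⊓n≤n (k ∸ x) Δ) x+r≤k)
  where
  x r : ℕ
  x = ∣ C ∩ B ∣
  r = (k ∸ x) ⊓ Δ
  x≤k : x ≤ k
  x≤k = subst (x ≤_) ∣C∣≡k (∣p∩q∣≤∣p∣ C B)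
  x+r≤k : x + r ≤ k
  x+r≤k = subst (x + r ≤_) (m+[n∸m]≡n x≤k) (+-monoʳ-≤ x (m⊓n≤m (k ∸ x) Δ))
  k≤x+r+tΔ : k ≤ x + r + t * Δ
  k≤x+r+tΔ = subst (k ≤_) (sym x+r+tΔ≡min)
    (⊓-glb (≤-trans (m≤n+m∸n k x) (m≤m+n (x + (k ∸ x)) (t * Δ)))
           (subst (k ≤_) (sym (+-assoc x Δ (t * Δ))) k≤x+Δ+tΔ))
    where
    x+r+tΔ≡min : x + r + t * Δ ≡ (x + (k ∸ x) + t * Δ) ⊓ (x + Δ + t * Δ)
    x+r+tΔ≡min = trans (cong (_+ t * Δ) (+-distribˡ-⊓ x (k ∸ x) Δ))
                       (+-distribʳ-⊓ (t * Δ) (x + (k ∸ x)) (x + Δ))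
  from-C′ : ∃[ C′ ] ∣ C′ ∣ ≡ k × Walk v k i C C′ 2 × ∣ C′ ∩ B ∣ ≡ x + r →
            Walk v k i C B (suc t + suc t)
  from-C′ (C′ , ∣C′∣≡k , C⇝C′ , ∣C′∩B∣≡x+r) =
    subst (Walk v k i C B) (cong suc (sym (+-suc t t))) (C⇝C′ ++ᵂ C′⇝B)
    where
    C′⇝B : Walk v k i C′ B (t + t)
    C′⇝B = even-walk 2k≤v Δ+2k≡v+2i ∣C′∣≡k ∣B∣≡k
             (subst (i ≤_) (sym ∣C′∩B∣≡x+r) (≤-trans i≤x (m≤m+n x r))) t
             (subst (λ z → k ≤ z + t * Δ) (sym ∣C′∩B∣≡x+r) k≤x+r+tΔ)

odd-walk : ∀ {v k i Δ} {C B : Subset v} → 2 * k ≤ v → Δ + 2 * k ≡ v + 2 * i →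
  ∣ C ∣ ≡ k → ∣ B ∣ ≡ k → i ≤ ∣ C ∩ B ∣ → ∀ t → ∣ C ∩ B ∣ ≤ i + t * Δ →
  Walk v k i C B (suc (t + t))
odd-walk {v} {k} {i} {Δ} {C} {B} 2k≤v Δ+2k≡v+2i ∣C∣≡k ∣B∣≡k i≤x t x≤i+tΔ =
  from-D (∃-neighbour-meeting C B (i + s) 2k≤v Δ+2k≡v+2i ∣C∣≡k ∣B∣≡k i≤x (m≤m+n i s) (z≤n {n = Δ})
            (trans (swap x i s) (cong (_+ i) x+s≡k)))
  where
  x s : ℕ
  x = ∣ C ∩ B ∣
  s = k ∸ x
  x+s≡k : x + s ≡ k
  x+s≡k = m+[n∸m]≡n (subst (x ≤_) ∣C∣≡k (∣p∩q∣≤∣p∣ C B))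
  swap : ∀ x i s → x + (i + s) + 0 ≡ x + s + i
  swap = solve-∀
  shift : ∀ i d s → i + d + s ≡ i + s + d
  shift = solve-∀
  from-D : ∃[ D ] ∣ D ∣ ≡ k × Adj v k i C D × ∣ D ∩ B ∣ ≡ i + s → Walk v k i C B (suc (t + t))
  from-D (D , ∣D∣≡k , C~D , ∣D∩B∣≡i+s) =
    step ∣D∣≡k C~D (even-walk 2k≤v Δ+2k≡v+2i ∣D∣≡k ∣B∣≡k
      (subst (i ≤_) (sym ∣D∩B∣≡i+s) (m≤m+n i s)) t
      (subst₂ _≤_ x+s≡k (trans (shift i (t * Δ) s) (cong (_+ t * Δ) (sym ∣D∩B∣≡i+s)))
         (+-monoˡ-≤ s x≤i+tΔ)))

m≤ceilDiv[m,n]*n : ∀ m n → 0 < n → m ≤ ceilDiv m n * n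
m≤ceilDiv[m,n]*n m (suc n) _ = +-cancelʳ-≤ n m (m+n/1+n * suc n) (begin
  m + n                              ≡⟨ m≡m%n+[m/n]*n (m + n) (suc n) ⟩
  (m + n) % suc n + m+n/1+n * suc n  ≤⟨ +-monoˡ-≤ _ (≤-pred (m%n<n (m + n) (suc n))) ⟩
  n + m+n/1+n * suc n                ≡⟨ +-comm n _ ⟩
  m+n/1+n * suc n + n                ∎)
  where
  open ≤-Reasoning
  m+n/1+n : ℕ
  m+n/1+n = (m + n) / suc n

m≤o*n⇒ceilDiv[m,n]≤o : ∀ m n o → 0 < n → m ≤ o * n → ceilDiv m n ≤ o
m≤o*n⇒ceilDiv[m,n]≤o m (suc n) o _ m≤o*n = ≤-pred (m<n*o⇒m/o<n {m + n} {suc o} {suc n} (s≤s (begin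
  m + n            ≤⟨ +-monoˡ-≤ n m≤o*n ⟩
  o * suc n + n    ≡⟨ +-comm (o * suc n) n ⟩
  n + o * suc n    ∎)))
  where open ≤-Reasoning

even-or-odd : ∀ n → ∃[ t ] (n ≡ t + t ⊎ n ≡ suc (t + t))
even-or-odd zero = 0 , inj₁ refl
even-or-odd (suc n) with even-or-odd n
... | t , inj₁ n≡t+t = t , inj₂ (cong suc n≡t+t)
... | t , inj₂ n≡1+t+t = suc t , inj₁ (cong suc (trans n≡1+t+t (sym (+-suc t t))))

least-of-even-and-odd : (W : ℕ → Set) (p q : ℕ) →
  W (p + p) → W (suc (q + q)) →
  (∀ t → W (t + t) → p ≤ t) → (∀ t → W (suc (t + t)) → q ≤ t) →
  W (2 * p ⊓ (2 * q + 1)) × (∀ n → W n → 2 * p ⊓ (2 * q + 1) ≤ n)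
least-of-even-and-odd W p q W[p+p] W[1+q+q] even-least odd-least = attained , least
  where
  2p≡p+p : 2 * p ≡ p + p
  2p≡p+p = cong (p +_) (+-identityʳ p)
  2q+1≡1+q+q : 2 * q + 1 ≡ suc (q + q)
  2q+1≡1+q+q = trans (+-comm (2 * q) 1) (cong (λ z → suc (q + z)) (+-identityʳ q))
  attained : W (2 * p ⊓ (2 * q + 1))
  attained with ≤-total (2 * p) (2 * q + 1)
  ... | inj₁ 2p≤ = subst W (sym (trans (m≤n⇒m⊓n≡m 2p≤) 2p≡p+p)) W[p+p]
  ... | inj₂ 2q+1≤ = subst W (sym (trans (m≥n⇒m⊓n≡n 2q+1≤) 2q+1≡1+q+q)) W[1+q+q]
  least : ∀ n → W n → 2 * p ⊓ (2 * q + 1) ≤ n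
  least n Wn with even-or-odd n
  ... | t , inj₁ refl = ≤-trans (m⊓n≤m _ _)
          (subst (_≤ t + t) (sym 2p≡p+p) (+-mono-≤ p≤t p≤t))
    where
    p≤t : p ≤ t
    p≤t = even-least t Wn
  ... | t , inj₂ refl = ≤-trans (m⊓n≤n _ _)
          (subst (_≤ suc (t + t)) (sym 2q+1≡1+q+q) (s≤s (+-mono-≤ q≤t q≤t)))
    where
    q≤t : q ≤ t
    q≤t = odd-least t Wn

v∸2k+2i+2k≡v+2i : ∀ v k i → 2 * k ≤ v → v ∸ 2 * k + 2 * i + 2 * k ≡ v + 2 * i
v∸2k+2i+2k≡v+2i v k i 2k≤v =
  trans (swap (v ∸ 2 * k) (2 * i) (2 * k)) (cong (_+ 2 * i) (m∸n+n≡m 2k≤v))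
  where
  swap : ∀ a b c → a + b + c ≡ a + c + b
  swap = solve-∀

0<v∸2k+2i : ∀ v k i → 2 * k ≤ v → ¬ (v ≡ 2 * k × i ≡ 0) → 0 < v ∸ 2 * k + 2 * i
0<v∸2k+2i v k (suc i) _ _ = ≤-trans (s≤s z≤n) (m≤n+m _ _)
0<v∸2k+2i v k zero 2k≤v not-degenerate with v ∸ 2 * k in v∸2k≡
... | suc _ = s≤s z≤n
... | zero  = contradiction (trans (sym (m∸n+n≡m 2k≤v)) (cong (_+ 2 * k) v∸2k≡) , refl)
                            not-degenerate

lemma3p3 : (v k i : ℕ) → i < k → k < v → 2 * k ≤ v →
    ¬ ((v ≡ 2 * k) × (i ≡ 0)) →
    (A B : Subset v) → ∣ A ∣ ≡ k → ∣ B ∣ ≡ k →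
    i < ∣ A ∩ B ∣ →
    IsDist v k i A B
      ((2 * ceilDiv (k ∸ ∣ A ∩ B ∣) (v ∸ 2 * k + 2 * i))
        ⊓ (2 * ceilDiv (∣ A ∩ B ∣ ∸ i) (v ∸ 2 * k + 2 * i) + 1))
lemma3p3 v k i _ _ 2k≤v not-degenerate A B ∣A∣≡k ∣B∣≡k i<x =
  least-of-even-and-odd (Walk v k i A B) p q
    (even-walk 2k≤v Δ+2k≡v+2i ∣A∣≡k ∣B∣≡k i≤x p
      (≤-trans (m≤n+m∸n k x) (+-monoʳ-≤ x (m≤ceilDiv[m,n]*n (k ∸ x) Δ 0<Δ))))
    (odd-walk 2k≤v Δ+2k≡v+2i ∣A∣≡k ∣B∣≡k i≤x q
      (≤-trans (m≤n+m∸n x i) (+-monoʳ-≤ i (m≤ceilDiv[m,n]*n (x ∸ i) Δ 0<Δ))))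
    (λ t w → m≤o*n⇒ceilDiv[m,n]≤o (k ∸ x) Δ t 0<Δ
      (m≤n+o⇒m∸n≤o k x (even-walk-bound Δ+2k≡v+2i ∣A∣≡k ∣B∣≡k t w)))
    (λ t w → m≤o*n⇒ceilDiv[m,n]≤o (x ∸ i) Δ t 0<Δ
      (m≤n+o⇒m∸n≤o x i (odd-walk-bound Δ+2k≡v+2i ∣A∣≡k ∣B∣≡k t w)))
  where
  x Δ p q : ℕ
  x = ∣ A ∩ B ∣
  Δ = v ∸ 2 * k + 2 * i
  p = ceilDiv (k ∸ x) Δ
  q = ceilDiv (x ∸ i) Δ
  i≤x : i ≤ x
  i≤x = <⇒≤ i<x
  Δ+2k≡v+2i : Δ + 2 * k ≡ v + 2 * i
  Δ+2k≡v+2i = v∸2k+2i+2k≡v+2i v k i 2k≤v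
  0<Δ : 0 < Δ
  0<Δ = 0<v∸2k+2i v k i 2k≤v not-degenerate
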